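{- Let $\mathbb M=(M_1,\dots,M_k)$ with $M_i=(E_i,\mathcal B_i)$ matroids, let $\mathbb B=(B_1,\dots,B_k)$ be a feasible basis sequence of $\mathbb M$, let $W$ be a shortcut-free tadpole-walk in $D(\mathbb M,\mathbb B)$, and let $W'$ be a valid subgraph of $W$. Then $\mathbb B\mathbin{\triangle} W'$ is a feasible basis sequence of $\mathbb M$.
   Context: A basis sequence of $\mathbb M$ is $(B_1,\dots,B_k)$ with $B_i\in\mathcal B_i$; feasible means pairwise disjoint. For a matroid $M=(E,\mathcal B)$ and $B\in\mathcal B$, the exchangeability graph $D(M,B)$ is the directed graph on vertex set $E$ with arc set $\{(x,y): x\in B,\ y\in E\setminus B,\ B-x+y\in\mathcal B\}$. $D(\mathbb M,\mathbb B)$ is the union of the graphs $D(M_i,B_i)=(E_i,A_i)$, $i\in[k]$, on vertex set $E=\bigcup_i E_i$ (the arc sets $A_i$ are pairwise disjoint). A tadpole-walk is a walk $(x_0,a_1,x_1,\dots,a_m,x_m=x_0,a_{m+1},x_{m+1},\dots,a_n,x_n)$ with $0\le m<n$ such that $(x_0,a_1,\dots,a_m,x_m)$ is a directed cycle (empty if $m=0$), $(x_m,a_{m+1},\dots,a_n,x_n)$ is a directed path with $x_n\in E\setminus\bigcup_i B_i$, and $x_0,\dots,x_n$ are distinct except $x_0=x_m$ when $m>0$. On the vertices of $W$ define the total order $\prec$ where $x_0$ is smallest and otherwise $x_i\prec x_j$ iff $i<j$. $W$ is shortcut-free if for every $i\in[k]$ and every two arcs $a,a'\in W\cap A_i$ with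 $\mathrm{tail}(a)\prec\mathrm{tail}(a')$, $(\mathrm{tail}(a),\mathrm{head}(a'))\notin A_i$. A subgraph $W'$ of $D(\mathbb M,\mathbb B)$ is valid if it is the disjoint union of a (possibly empty) directed path ending at a vertex of $E\setminus\bigcup_i B_i$ and a (possibly empty) directed cycle. For a valid $W'$, $W'\cap A_i$ is a matching $\{(x_1,y_1),\dots,(x_r,y_r)\}$ and $B_i\mathbin{\triangle}(W'\cap A_i):=(B_i\setminus\{x_1,\dots,x_r\})\cup\{y_1,\dots,y_r\}$; then $\mathbb B\mathbin{\triangle}W':=(B_1\mathbin{\triangle}(W'\cap A_1),\dots,B_k\mathbin{\triangle}(W'\cap A_k))$. -}

module Defs where

open import Data.Nat using (ℕ; zero; suc; _<_; _≤_)
open import Data.Fin using (Fin) renaming (_≟_ to _≟ᶠ_)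
open import Data.Fin.Subset using (Subset; _∈_; _∉_; _⊆_; _∪_; _─_; _-_; ⁅_⁆)
  renaming (⊥ to ∅)
open import Data.List using (List; []; _∷_; _++_; map; foldr)
open import Data.List.Relation.Unary.All using (All)
open import Data.List.Relation.Unary.Unique.Propositional using (Unique)
open import Data.Product using (Σ; ∃; _×_)
open import Data.Sum using (_⊎_)
open import Data.Unit using (⊤)
open import Data.Bool using (if_then_else_)
open import Relation.Nullary using (¬_; does)
open import Relation.Binary.PropositionalEquality using (_≡_; _≢_)

record Matroid (N : ℕ) : Set₁ where
  field
    E        : Subset N
    IsBasis  : Subset N → Set
    basis⊆E  : ∀ {B} → IsBasis B → B ⊆ E
    nonempty : ∃ IsBasis
    exchange : ∀ {B₁ B₂ x} → IsBasis B₁ → IsBasis B₂ → x ∈ B₁ → x ∉ B₂ →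
               Σ (Fin N) λ y → y ∈ B₂ × y ∉ B₁ × IsBasis ((B₁ - x) ∪ ⁅ y ⁆)
open Matroid public

FeasibleBasisSeq : ∀ {N k} → (Fin k → Matroid N) → (Fin k → Subset N) → Set
FeasibleBasisSeq 𝕄 𝔹 =
  (∀ i → IsBasis (𝕄 i) (𝔹 i)) ×
  (∀ i j → i ≢ j → ∀ v → v ∈ 𝔹 i → v ∉ 𝔹 j)

Arc : ∀ {N k} → (Fin k → Matroid N) → (Fin k → Subset N) → Fin k → Fin N → Fin N → Set
Arc 𝕄 𝔹 i u v =
  u ∈ 𝔹 i × v ∈ E (𝕄 i) × v ∉ 𝔹 i × IsBasis (𝕄 i) ((𝔹 i - u) ∪ ⁅ v ⁆)

Uncovered : ∀ {N k} → (Fin k → Subset N) → Fin N → Set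
Uncovered 𝔹 v = ∀ i → v ∉ 𝔹 i

-- A tadpole-walk (x_0, a_1, x_1, ..., a_n, x_n) in D(𝕄,𝔹).
-- Vertices are x j (j ≤ n); the arc a_{j+1} goes from x j to x (suc j)
-- and belongs to A_{lab j}.
record TadpoleWalk {N k} (𝕄 : Fin k → Matroid N) (𝔹 : Fin k → Subset N) : Set where
  field
    n m      : ℕ
    x        : ℕ → Fin N
    lab      : ℕ → Fin k
    m<n      : m < n
    arcs     : ∀ j → j < n → Arc 𝕄 𝔹 (lab j) (x j) (x (suc j))
    closed   : 0 < m → x m ≡ x 0
    end      : Uncovered 𝔹 (x n)
    distinct : ∀ i j → i ≤ n → j ≤ n → x i ≡ x j →
               i ≡ j ⊎ (0 < m × ((i ≡ 0 × j ≡ m) ⊎ (i ≡ m × j ≡ 0)))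
open TadpoleWalk public

-- rank of the vertex x j in the order ≺ (x_m = x_0 is the smallest)
pos : ∀ {N k} {𝕄 : Fin k → Matroid N} {𝔹 : Fin k → Subset N} →
      TadpoleWalk 𝕄 𝔹 → ℕ → ℕ
pos W j = if does (j Data.Nat.≟ m W) then 0 else j

ShortcutFree : ∀ {N k} {𝕄 : Fin k → Matroid N} {𝔹 : Fin k → Subset N} →
               TadpoleWalk 𝕄 𝔹 → Set
ShortcutFree {𝕄 = 𝕄} {𝔹} W =
  ∀ i j j' → j < n W → j' < n W → lab W j ≡ i → lab W j' ≡ i →
  pos W j < pos W j' → ¬ Arc 𝕄 𝔹 i (x W j) (x W (suc j'))

module _ {N k} {𝕄 : Fin k → Matroid N} {𝔹 : Fin k → Subset N}
         (W : TadpoleWalk 𝕄 𝔹) where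
  Steps : ℕ → List ℕ → (Fin N → Set) → Set
  Steps a []      P = P (x W (suc a))
  Steps a (b ∷ r) P = x W (suc a) ≡ x W b × Steps b r P

  IsPath : List ℕ → Set
  IsPath []      = ⊤
  IsPath (a ∷ r) = Steps a r (Uncovered 𝔹)

  IsCycle : List ℕ → Set
  IsCycle []      = ⊤
  IsCycle (c ∷ r) = Steps c r (λ v → v ≡ x W c)

  pathVerts : List ℕ → List (Fin N)
  pathVerts []          = []
  pathVerts (a ∷ [])    = x W a ∷ x W (suc a) ∷ []
  pathVerts (a ∷ b ∷ r) = x W a ∷ pathVerts (b ∷ r)

-- Arcs are given by their indices j (arc a_{j+1}).
record ValidSubgraph {N k} {𝕄 : Fin k → Matroid N} {𝔹 : Fin k → Subset N}
                     (W : TadpoleWalk 𝕄 𝔹) : Set where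
  field
    pathArcs  : List ℕ
    cycArcs   : List ℕ
    pathInW   : All (_< n W) pathArcs
    cycInW    : All (_< n W) cycArcs
    isPath    : IsPath W pathArcs
    isCycle   : IsCycle W cycArcs
    distinctV : Unique (pathVerts W pathArcs ++ map (x W) cycArcs)
open ValidSubgraph public

_△_ : ∀ {N k} {𝕄 : Fin k → Matroid N} (𝔹 : Fin k → Subset N) {W : TadpoleWalk 𝕄 𝔹} →
      ValidSubgraph W → Fin k → Subset N
_△_ {N} 𝔹 {W} W' i = (𝔹 i ─ sel (x W)) ∪ sel (λ j → x W (suc j))
  where
    sel : (ℕ → Fin N) → Subset _
    sel f = foldr (λ j S → if does (lab W j ≟ᶠ i) then ⁅ f j ⁆ ∪ S else S) ∅
                  (pathArcs W' ++ cycArcs W')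

-- The arcs of W′ in A_i form a matching (x₁,y₁),…,(x_r,y_r) of D(M_i,B_i);
-- listed in ≺-order of their tails, shortcut-freeness says that (x_j, y_l) is not an arc for
-- j < l. Performing the exchanges one at a time preserves this situation: after exchanging
-- (z, w), a pair (x, y) is still an exchange, and a non-exchange stays one, as long as (z, y)
-- is not an exchange. Induction shows that B_i △ W′ is a basis.
-- For disjointness, a vertex added to B_j is the head of an arc of W′. Since W′ is a path
-- ending outside ⋃ B_l together with a cycle, a head lying in B_i is the tail of another arc
-- of W′, which belongs to A_i because the B_l are disjoint; so that vertex leaves B_i.
module Submission where

open import Data.Bool using (if_then_else_)
open import Data.Empty using (⊥-elim)
open import Data.Fin using (Fin) renaming (_≟_ to _≟ᶠ_)
open import Data.Fin.Subset using (Subset; _∈_; _∉_; _∪_; _─_; _-_; ⁅_⁆) renaming (⊥ to ∅)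
open import Data.Fin.Subset.Properties
  using ( x∈p∪q⁻; x∈p∪q⁺; p─q⊆p; x∈p∧x∉q⇒x∈p─q; x∈⁅y⁆⇒x≡y; x∈⁅x⁆; ⊆-antisym
        ; x≢y⇒x∉⁅y⁆; x∉⁅y⁆⇒x≢y; ∉⊥)
open import Data.List using (List; []; _∷_; _++_; map; filter; foldr; upTo)
open import Data.List.Membership.Propositional using () renaming (_∈_ to _∈ˡ_; _∉_ to _∉ˡ_)
open import Data.List.Membership.Propositional.Properties
  using (∈-map⁺; ∈-map⁻; ∈-filter⁺; ∈-filter⁻; ∈-upTo⁺; ∈-++⁻; ∈-++⁺ˡ; ∈-++⁺ʳ)
open import Data.List.Properties using (map-++; map-∘)
open import Data.List.Relation.Binary.Subset.Propositional using () renaming (_⊆_ to _⊆ˡ_)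
import Data.List.Relation.Binary.Subset.Propositional.Properties as Sub
open import Data.List.Relation.Unary.All as All using (All; []; _∷_)
open import Data.List.Relation.Unary.All.Properties using (all-filter) renaming (map⁺ to All-map⁺)
open import Data.List.Relation.Unary.AllPairs using (AllPairs; []; _∷_)
import Data.List.Relation.Unary.AllPairs.Properties as AllPairs
open import Data.List.Relation.Unary.Any using (here; there)
open import Data.List.Relation.Unary.Unique.Propositional using (Unique)
open import Data.Nat using (ℕ; suc; _<_; _≤_; z≤n; _≟_)
open import Data.List.Membership.DecPropositional _≟_ using (_∈?_)
open import Data.Nat.Properties using (suc-injective; n≢0⇒n>0; <⇒≢; <⇒≤; m≤n⇒m<n∨m≡n)
open import Data.Product using (∃; _×_; _,_; proj₁; proj₂)
open import Data.Sum using (_⊎_; inj₁; inj₂)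
open import Data.Vec using (_∷_; there)
open import Function using (_∘′_; id)
open import Function.Bundles using (_⇔_; mk⇔; Equivalence)
open import Relation.Binary.PropositionalEquality using (_≡_; _≢_; refl; sym; trans; subst; subst₂; cong)
open import Relation.Nullary using (¬_; yes; no; does)
open import Relation.Nullary.Decidable using (dec-true; dec-false; ¬?)
open import Relation.Unary using (Decidable)

open import Defs

Unique-map⇒injective : ∀ {A B : Set} (f : A → B) {xs} → Unique (map f xs) →
                       ∀ {a b} → a ∈ˡ xs → b ∈ˡ xs → f a ≡ f b → a ≡ b
Unique-map⇒injective f {_ ∷ _} (_ ∷ u) (here refl) (here refl) _ = refl
Unique-map⇒injective f {_ ∷ _} (fa∉ ∷ _) (here refl) (there b∈) eq =
  ⊥-elim (All.lookup fa∉ (∈-map⁺ f b∈) eq)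
Unique-map⇒injective f {_ ∷ _} (fb∉ ∷ _) (there a∈) (here refl) eq =
  ⊥-elim (All.lookup fb∉ (∈-map⁺ f a∈) (sym eq))
Unique-map⇒injective f {_ ∷ _} (_ ∷ u) (there a∈) (there b∈) eq = Unique-map⇒injective f u a∈ b∈ eq

AllPairs-map-All : ∀ {A : Set} {P : A → Set} {R S : A → A → Set} {xs} →
                   (∀ {a b} → P a → P b → R a b → S a b) →
                   All P xs → AllPairs R xs → AllPairs S xs
AllPairs-map-All f [] [] = []
AllPairs-map-All f (pa ∷ pxs) (rs ∷ rss) =
  All.zipWith (λ (pb , r) → f pa pb r) (pxs , rs) ∷ AllPairs-map-All f pxs rss

x∈p─q⇒x∉q : ∀ {n} (p q : Subset n) {x} → x ∈ p ─ q → x ∉ q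
x∈p─q⇒x∉q (_ ∷ p) (_ ∷ q) (there x∈) (there x∈q) = x∈p─q⇒x∉q p q x∈ x∈q

module _ {N : ℕ} where

  infixl 6 _[_↦_]

  _[_↦_] : Subset N → Fin N → Fin N → Subset N
  S [ a ↦ b ] = (S - a) ∪ ⁅ b ⁆

  ∈-[↦]⁻ : ∀ {S a b v} → v ∈ S [ a ↦ b ] → (v ∈ S × v ≢ a) ⊎ v ≡ b
  ∈-[↦]⁻ {S} {a} {b} v∈ with x∈p∪q⁻ (S - a) ⁅ b ⁆ v∈
  ... | inj₁ v∈S-a = inj₁ (p─q⊆p S ⁅ a ⁆ v∈S-a , x∉⁅y⁆⇒x≢y (x∈p─q⇒x∉q S ⁅ a ⁆ v∈S-a))
  ... | inj₂ v∈⁅b⁆ = inj₂ (x∈⁅y⁆⇒x≡y b v∈⁅b⁆)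

  kept : ∀ {S a b v} → v ∈ S → v ≢ a → v ∈ S [ a ↦ b ]
  kept v∈S v≢a = x∈p∪q⁺ (inj₁ (x∈p∧x∉q⇒x∈p─q v∈S (x≢y⇒x∉⁅y⁆ v≢a)))

  added : ∀ {S a b} → b ∈ S [ a ↦ b ]
  added {b = b} = x∈p∪q⁺ (inj₂ (x∈⁅x⁆ b))

  not-added : ∀ {S a b v} → v ∉ S → v ≢ b → v ∉ S [ a ↦ b ]
  not-added v∉S v≢b v∈ with ∈-[↦]⁻ v∈
  ... | inj₁ (v∈S , _) = v∉S v∈S
  ... | inj₂ v≡b = v≢b v≡b

  removed : ∀ {S a b} → a ≢ b → a ∉ S [ a ↦ b ]
  removed a≢b a∈ with ∈-[↦]⁻ a∈
  ... | inj₁ (_ , a≢a) = a≢a refl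
  ... | inj₂ a≡b = a≢b a≡b

  [↦]-comm : ∀ {S a b c d} → b ≢ c → d ≢ a → S [ a ↦ b ] [ c ↦ d ] ≡ S [ c ↦ d ] [ a ↦ b ]
  [↦]-comm b≢c d≢a = ⊆-antisym (commute b≢c d≢a) (commute d≢a b≢c)
    where
    commute : ∀ {S a b c d} → b ≢ c → d ≢ a → ∀ {v} →
              v ∈ S [ a ↦ b ] [ c ↦ d ] → v ∈ S [ c ↦ d ] [ a ↦ b ]
    commute b≢c d≢a v∈ with ∈-[↦]⁻ v∈
    ... | inj₂ refl = kept added d≢a
    ... | inj₁ (v∈′ , v≢c) with ∈-[↦]⁻ v∈′
    ...   | inj₂ refl = added
    ...   | inj₁ (v∈S , v≢a) = kept (kept v∈S v≢c) v≢a

  [↦]-reroute : ∀ {S a b c} → a ∈ S → a ≢ c → b ≢ c → S [ a ↦ b ] [ c ↦ a ] ≡ S [ c ↦ b ]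
  [↦]-reroute {S} {a} {b} {c} a∈S a≢c b≢c = ⊆-antisym to from
    where
    to : ∀ {v} → v ∈ S [ a ↦ b ] [ c ↦ a ] → v ∈ S [ c ↦ b ]
    to v∈ with ∈-[↦]⁻ v∈
    ... | inj₂ refl = kept a∈S a≢c
    ... | inj₁ (v∈′ , v≢c) with ∈-[↦]⁻ v∈′
    ...   | inj₂ refl = added
    ...   | inj₁ (v∈S , _) = kept v∈S v≢c
    from : ∀ {v} → v ∈ S [ c ↦ b ] → v ∈ S [ a ↦ b ] [ c ↦ a ]
    from {v} v∈ with v ≟ᶠ a | ∈-[↦]⁻ v∈
    ... | yes refl | _ = added
    ... | no v≢a | inj₂ refl = kept added b≢c
    ... | no v≢a | inj₁ (v∈S , v≢c) = kept (kept v∈S v≢a) v≢c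

  [↦]-trans : ∀ {S a b c} → b ∉ S → S [ a ↦ b ] [ b ↦ c ] ≡ S [ a ↦ c ]
  [↦]-trans {S} {a} {b} {c} b∉S = ⊆-antisym to from
    where
    to : ∀ {v} → v ∈ S [ a ↦ b ] [ b ↦ c ] → v ∈ S [ a ↦ c ]
    to v∈ with ∈-[↦]⁻ v∈
    ... | inj₂ refl = added
    ... | inj₁ (v∈′ , v≢b) with ∈-[↦]⁻ v∈′
    ...   | inj₂ v≡b = ⊥-elim (v≢b v≡b)
    ...   | inj₁ (v∈S , v≢a) = kept v∈S v≢a
    from : ∀ {v} → v ∈ S [ a ↦ c ] → v ∈ S [ a ↦ b ] [ b ↦ c ]
    from v∈ with ∈-[↦]⁻ v∈
    ... | inj₂ refl = added
    ... | inj₁ (v∈S , v≢a) = kept (kept v∈S v≢a) λ { refl → b∉S v∈S }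

  [↦]-id : ∀ {S a} → a ∈ S → S [ a ↦ a ] ≡ S
  [↦]-id {S} {a} a∈S = ⊆-antisym to from
    where
    to : ∀ {v} → v ∈ S [ a ↦ a ] → v ∈ S
    to v∈ with ∈-[↦]⁻ v∈
    ... | inj₂ refl = a∈S
    ... | inj₁ (v∈S , _) = v∈S
    from : ∀ {v} → v ∈ S → v ∈ S [ a ↦ a ]
    from {v} v∈S with v ≟ᶠ a
    ... | yes refl = added
    ... | no v≢a = kept v∈S v≢a

module _ {N : ℕ} {A : Set} {P : A → Set} (P? : Decidable P) (f : A → Fin N) where

  -- The fold used in the definition of _△_, so that ∈-select⇔ applies to it definitionally.
  select : List A → Subset N
  select = foldr (λ j S → if does (P? j) then ⁅ f j ⁆ ∪ S else S) ∅

  ∈-select⇔ : ∀ xs {v} → v ∈ select xs ⇔ v ∈ˡ map f (filter P? xs)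
  ∈-select⇔ xs = mk⇔ (to xs) (from xs)
    where
    to : ∀ xs {v} → v ∈ select xs → v ∈ˡ map f (filter P? xs)
    to [] v∈ = ⊥-elim (∉⊥ v∈)
    to (j ∷ xs) v∈ with P? j
    ... | no _ = to xs v∈
    ... | yes _ with x∈p∪q⁻ ⁅ f j ⁆ (select xs) v∈
    ...   | inj₁ v∈⁅fj⁆ = here (x∈⁅y⁆⇒x≡y (f j) v∈⁅fj⁆)
    ...   | inj₂ v∈rest = there (to xs v∈rest)
    from : ∀ xs {v} → v ∈ˡ map f (filter P? xs) → v ∈ select xs
    from (j ∷ xs) v∈ with P? j
    ... | no _ = from xs v∈
    ... | yes _ with v∈
    ...   | here refl = x∈p∪q⁺ (inj₁ (x∈⁅x⁆ (f j)))
    ...   | there v∈rest = x∈p∪q⁺ {p = ⁅ f j ⁆} (inj₂ (from xs v∈rest))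

module _ {N : ℕ} where

  exchangeAll : Subset N → List (Fin N × Fin N) → Subset N
  exchangeAll S [] = S
  exchangeAll S ((x , y) ∷ ps) = exchangeAll (S [ x ↦ y ]) ps

  ∈-exchangeAll⇔ : ∀ {S ps v} →
    All (λ (x , y) → x ∈ S × y ∉ S) ps →
    AllPairs (λ (x , y) (x′ , y′) → x ≢ x′ × y ≢ y′) ps →
    v ∈ exchangeAll S ps ⇔ ((v ∈ S × v ∉ˡ map proj₁ ps) ⊎ v ∈ˡ map proj₂ ps)
  ∈-exchangeAll⇔ [] [] =
    mk⇔ (λ v∈S → inj₁ (v∈S , λ ())) λ { (inj₁ (v∈S , _)) → v∈S ; (inj₂ ()) }
  ∈-exchangeAll⇔ {S} {(x , y) ∷ ps} {v} ((x∈S , y∉S) ∷ inS) (distinct ∷ distincts) = mk⇔ to from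
    where
    inS′ : All (λ (x′ , y′) → x′ ∈ S [ x ↦ y ] × y′ ∉ S [ x ↦ y ]) ps
    inS′ = All.zipWith (λ ((x′∈S , y′∉S) , (x≢x′ , y≢y′)) →
                          kept x′∈S (x≢x′ ∘′ sym) , not-added y′∉S (y≢y′ ∘′ sym))
                       (inS , distinct)
    module IH = Equivalence (∈-exchangeAll⇔ {S [ x ↦ y ]} {ps} {v} inS′ distincts)
    y∉tails : y ∉ˡ map proj₁ ps
    y∉tails y∈ with ∈-map⁻ proj₁ y∈
    ... | _ , q∈ps , refl = y∉S (proj₁ (All.lookup inS q∈ps))

    to : v ∈ exchangeAll (S [ x ↦ y ]) ps →
         (v ∈ S × v ∉ˡ x ∷ map proj₁ ps) ⊎ v ∈ˡ y ∷ map proj₂ ps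
    to v∈ with IH.to v∈
    ... | inj₂ v∈heads = inj₂ (there v∈heads)
    ... | inj₁ (v∈S′ , v∉tails) with ∈-[↦]⁻ v∈S′
    ...   | inj₁ (v∈S , v≢x) =
      inj₁ (v∈S , λ { (here v≡x) → v≢x v≡x ; (there v∈tails) → v∉tails v∈tails })
    ...   | inj₂ refl = inj₂ (here refl)

    from : (v ∈ S × v ∉ˡ x ∷ map proj₁ ps) ⊎ v ∈ˡ y ∷ map proj₂ ps →
           v ∈ exchangeAll (S [ x ↦ y ]) ps
    from (inj₁ (v∈S , v∉tails)) = IH.from (inj₁ (kept v∈S (v∉tails ∘′ here) , v∉tails ∘′ there))
    from (inj₂ (here refl)) = IH.from (inj₁ (added , y∉tails))
    from (inj₂ (there v∈heads)) = IH.from (inj₂ v∈heads)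

module _ {N : ℕ} (M : Matroid N) where

  Exchangeable : Subset N → Fin N × Fin N → Set
  Exchangeable B (x , y) = x ∈ B × y ∉ B × IsBasis M (B [ x ↦ y ])

  NoShortcut : Subset N → Fin N × Fin N → Fin N × Fin N → Set
  NoShortcut B (x , y) (x′ , y′) = x ≢ x′ × y ≢ y′ × ¬ IsBasis M (B [ x ↦ y′ ])

  private
    ∈∉⇒≢ : ∀ {a b} {T : Subset N} → a ∈ T → b ∉ T → a ≢ b
    ∈∉⇒≢ a∈T b∉T refl = b∉T a∈T

  -- Both directions apply basis exchange between S [ x ↦ y ] and S [ z ↦ w ]; the only wrong
  -- element it could return is x, which would make (z, y) an exchange.
  exchange-after-exchange : ∀ {S x y z w} → IsBasis M S →
    Exchangeable S (z , w) → NoShortcut S (z , w) (x , y) → x ∈ S → y ∉ S →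
    IsBasis M (S [ x ↦ y ]) ⇔ IsBasis M (S [ z ↦ w ] [ x ↦ y ])
  exchange-after-exchange {S} {x} {y} {z} {w}
    S-basis (z∈S , w∉S , zw-basis) (z≢x , w≢y , ¬zy-basis) x∈S y∉S =
    mk⇔ forward backward
    where
    y≢z : y ≢ z
    y≢z = ∈∉⇒≢ z∈S y∉S ∘′ sym
    w≢x : w ≢ x
    w≢x = ∈∉⇒≢ x∈S w∉S ∘′ sym
    S[x↦y][z↦x] : S [ x ↦ y ] [ z ↦ x ] ≡ S [ z ↦ y ]
    S[x↦y][z↦x] = [↦]-reroute x∈S (z≢x ∘′ sym) y≢z
    w∉S[x↦y] : w ∉ S [ x ↦ y ]
    w∉S[x↦y] = not-added w∉S w≢y

    forward : IsBasis M (S [ x ↦ y ]) → IsBasis M (S [ z ↦ w ] [ x ↦ y ])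
    forward xy-basis with exchange M xy-basis zw-basis (kept z∈S z≢x) (removed (∈∉⇒≢ z∈S w∉S))
    ... | u , u∈ , u∉ , basis with ∈-[↦]⁻ u∈
    ...   | inj₂ refl = subst (IsBasis M) ([↦]-comm y≢z w≢x) basis
    ...   | inj₁ (u∈S , u≢z) with u ≟ᶠ x
    ...     | yes refl = ⊥-elim (¬zy-basis (subst (IsBasis M) S[x↦y][z↦x] basis))
    ...     | no u≢x = ⊥-elim (u∉ (kept u∈S u≢x))

    backward : IsBasis M (S [ z ↦ w ] [ x ↦ y ]) → IsBasis M (S [ x ↦ y ])
    backward basis′ with exchange M basis S-basis added w∉S
      where
      basis : IsBasis M (S [ x ↦ y ] [ z ↦ w ])
      basis = subst (IsBasis M) ([↦]-comm w≢x y≢z) basis′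
    ... | u , u∈S , u∉ , basis with u ≟ᶠ x | u ≟ᶠ z
    ...   | yes refl | _ =
      ⊥-elim (¬zy-basis (subst (IsBasis M) (trans ([↦]-trans w∉S[x↦y]) S[x↦y][z↦x]) basis))
    ...   | no _ | yes refl = subst (IsBasis M) (trans ([↦]-trans w∉S[x↦y]) ([↦]-id (kept z∈S z≢x))) basis
    ...   | no u≢x | no u≢z = ⊥-elim (u∉ (kept (kept u∈S u≢x) u≢z))

  exchangeAll-isBasis : ∀ {B ps} → IsBasis M B →
    All (Exchangeable B) ps → AllPairs (NoShortcut B) ps → IsBasis M (exchangeAll B ps)
  exchangeAll-isBasis B-basis [] [] = B-basis
  exchangeAll-isBasis {B} {(z , w) ∷ ps}
    B-basis (zw@(_ , _ , zw-basis) ∷ exchangeable) (after-zw ∷ no-shortcut) =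
    exchangeAll-isBasis zw-basis
      (All.zipWith still-exchangeable (exchangeable , after-zw))
      (AllPairs-map-All still-no-shortcut (All.zip (exchangeable , after-zw)) no-shortcut)
    where
    still-exchangeable : ∀ {q} → Exchangeable B q × NoShortcut B (z , w) q →
                         Exchangeable (B [ z ↦ w ]) q
    still-exchangeable ((x∈B , y∉B , xy-basis) , zw-xy@(z≢x , w≢y , _)) =
      kept x∈B (z≢x ∘′ sym) , not-added y∉B (w≢y ∘′ sym) ,
      Equivalence.to (exchange-after-exchange B-basis zw zw-xy x∈B y∉B) xy-basis

    still-no-shortcut : ∀ {q r} →
      Exchangeable B q × NoShortcut B (z , w) q → Exchangeable B r × NoShortcut B (z , w) r →
      NoShortcut B q r → NoShortcut (B [ z ↦ w ]) q r
    still-no-shortcut ((x∈B , _) , (z≢x , _)) ((_ , y′∉B , _) , (_ , w≢y′ , ¬zy′-basis))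
                      (x≢x′ , y≢y′ , ¬xy′-basis) =
      x≢x′ , y≢y′ ,
      ¬xy′-basis ∘′
        Equivalence.from (exchange-after-exchange B-basis zw (z≢x , w≢y′ , ¬zy′-basis) x∈B y′∉B)

PairwiseDisjoint : ∀ {N k} → (Fin k → Subset N) → Set
PairwiseDisjoint 𝔹 = ∀ i j → i ≢ j → ∀ v → v ∈ 𝔹 i → v ∉ 𝔹 j

module _ {N k} {𝕄 : Fin k → Matroid N} {𝔹 : Fin k → Subset N} (W : TadpoleWalk 𝕄 𝔹) where

  pos-m : pos W (m W) ≡ 0
  pos-m = cong (λ b → if b then 0 else m W) (dec-true (m W ≟ m W) refl)

  pos-≢m : ∀ {j} → j ≢ m W → pos W j ≡ j
  pos-≢m {j} j≢m = cong (λ b → if b then 0 else j) (dec-false (j ≟ m W) j≢m)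

  x-m≡x-0 : x W (m W) ≡ x W 0
  x-m≡x-0 with m W ≟ 0
  ... | yes m≡0 = cong (x W) m≡0
  ... | no m≢0 = closed W (n≢0⇒n>0 m≢0)

  x-pos : ∀ j → x W (pos W j) ≡ x W j
  x-pos j with j ≟ m W
  ... | yes refl = trans (cong (x W) pos-m) (sym x-m≡x-0)
  ... | no j≢m = cong (x W) (pos-≢m j≢m)

  heads-injective : ∀ {a b} → a < n W → b < n W → x W (suc a) ≡ x W (suc b) → a ≡ b
  heads-injective {a} {b} a<n b<n eq with distinct W (suc a) (suc b) a<n b<n eq
  ... | inj₁ sa≡sb = suc-injective sa≡sb
  ... | inj₂ (_ , inj₁ (() , _))
  ... | inj₂ (_ , inj₂ (_ , ()))

  -- Arc indices ordered by the ≺-rank of their tails; x_m = x_0 is smallest, so arc m comes first.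
  ≺-order : List ℕ
  ≺-order = m W ∷ filter (λ j → ¬? (j ≟ m W)) (upTo (n W))

  ∈-≺-order : ∀ {j} → j < n W → j ∈ˡ ≺-order
  ∈-≺-order {j} j<n with j ≟ m W
  ... | yes refl = here refl
  ... | no j≢m = there (∈-filter⁺ (λ j → ¬? (j ≟ m W)) (∈-upTo⁺ j<n) j≢m)

  ≺-order-sorted : AllPairs (λ a b → a ≢ b × pos W a ≤ pos W b) ≺-order
  ≺-order-sorted =
    All.map m-first (all-filter _ (upTo (n W))) ∷
    AllPairs-map-All increasing (all-filter _ (upTo (n W)))
      (AllPairs.filter⁺ _ (AllPairs.applyUpTo⁺₁ id (n W) (λ a<b _ → a<b)))
    where
    m-first : ∀ {b} → b ≢ m W → m W ≢ b × pos W (m W) ≤ pos W b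
    m-first {b} b≢m = b≢m ∘′ sym , subst (_≤ pos W b) (sym pos-m) z≤n
    increasing : ∀ {a b} → a ≢ m W → b ≢ m W → a < b → a ≢ b × pos W a ≤ pos W b
    increasing a≢m b≢m a<b = <⇒≢ a<b , subst₂ _≤_ (sym (pos-≢m a≢m)) (sym (pos-≢m b≢m)) (<⇒≤ a<b)

  All-pathVerts⇒tails : ∀ {P : Fin N → Set} ps zs →
                        All P (pathVerts W ps ++ zs) → All P (map (x W) ps ++ zs)
  All-pathVerts⇒tails []           zs all              = all
  All-pathVerts⇒tails (a ∷ [])     zs (pa ∷ _ ∷ all)   = pa ∷ all
  All-pathVerts⇒tails (a ∷ b ∷ ps) zs (pa ∷ all)       = pa ∷ All-pathVerts⇒tails (b ∷ ps) zs all

  Unique-pathVerts⇒tails : ∀ ps zs → Unique (pathVerts W ps ++ zs) → Unique (map (x W) ps ++ zs)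
  Unique-pathVerts⇒tails []           zs u                    = u
  Unique-pathVerts⇒tails (a ∷ [])     zs ((_ ∷ a∉) ∷ _ ∷ u)   = a∉ ∷ u
  Unique-pathVerts⇒tails (a ∷ b ∷ ps) zs (a∉ ∷ u)             =
    All-pathVerts⇒tails (b ∷ ps) zs a∉ ∷ Unique-pathVerts⇒tails (b ∷ ps) zs u

  Steps-continues : ∀ {Q : Fin N → Set} a r → Steps W a r Q → ∀ {d} → d ∈ˡ a ∷ r →
                    (∃ λ b → b ∈ˡ r × x W b ≡ x W (suc d)) ⊎ Q (x W (suc d))
  Steps-continues a []      q        (here refl) = inj₂ q
  Steps-continues a (b ∷ r) (eq , _) (here refl) = inj₁ (b , here refl , sym eq)
  Steps-continues a (b ∷ r) (_ , s)  (there d∈) with Steps-continues b r s d∈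
  ... | inj₁ (c , c∈r , eq) = inj₁ (c , there c∈r , eq)
  ... | inj₂ q = inj₂ q

  IsPath-continues : ∀ ps → IsPath W ps → ∀ {d} → d ∈ˡ ps →
                     (∃ λ b → b ∈ˡ ps × x W b ≡ x W (suc d)) ⊎ Uncovered 𝔹 (x W (suc d))
  IsPath-continues (a ∷ r) steps d∈ with Steps-continues a r steps d∈
  ... | inj₁ (b , b∈r , eq) = inj₁ (b , there b∈r , eq)
  ... | inj₂ uncovered = inj₂ uncovered

  IsCycle-continues : ∀ cs → IsCycle W cs → ∀ {d} → d ∈ˡ cs →
                      ∃ λ b → b ∈ˡ cs × x W b ≡ x W (suc d)
  IsCycle-continues (c ∷ r) steps d∈ with Steps-continues c r steps d∈
  ... | inj₁ (b , b∈r , eq) = b , there b∈r , eq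
  ... | inj₂ eq = c , here refl , sym eq

  module _ (W′ : ValidSubgraph W) where

    arcsW′ : List ℕ
    arcsW′ = pathArcs W′ ++ cycArcs W′

    arcsW′-in-W : ∀ {a} → a ∈ˡ arcsW′ → a < n W
    arcsW′-in-W a∈ with ∈-++⁻ (pathArcs W′) a∈
    ... | inj₁ a∈path = All.lookup (pathInW W′) a∈path
    ... | inj₂ a∈cyc = All.lookup (cycInW W′) a∈cyc

    tails-injective : ∀ {a b} → a ∈ˡ arcsW′ → b ∈ˡ arcsW′ → x W a ≡ x W b → a ≡ b
    tails-injective = Unique-map⇒injective (x W) unique-tails
      where
      unique-tails : Unique (map (x W) arcsW′)
      unique-tails = subst Unique (sym (map-++ (x W) (pathArcs W′) (cycArcs W′)))
                           (Unique-pathVerts⇒tails (pathArcs W′) _ (distinctV W′))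

    distinct-arcs : ∀ {a b} → a ∈ˡ arcsW′ → b ∈ˡ arcsW′ → a ≢ b →
                    x W a ≢ x W b × x W (suc a) ≢ x W (suc b)
    distinct-arcs a∈ b∈ a≢b =
      a≢b ∘′ tails-injective a∈ b∈ , a≢b ∘′ heads-injective (arcsW′-in-W a∈) (arcsW′-in-W b∈)

    head-continues : ∀ {a} → a ∈ˡ arcsW′ →
      Uncovered 𝔹 (x W (suc a)) ⊎ (∃ λ b → b ∈ˡ arcsW′ × x W b ≡ x W (suc a))
    head-continues a∈ with ∈-++⁻ (pathArcs W′) a∈
    ... | inj₂ a∈cyc with IsCycle-continues (cycArcs W′) (isCycle W′) a∈cyc
    ...   | b , b∈ , eq = inj₂ (b , ∈-++⁺ʳ (pathArcs W′) b∈ , eq)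
    head-continues a∈ | inj₁ a∈path with IsPath-continues (pathArcs W′) (isPath W′) a∈path
    ...   | inj₁ (b , b∈ , eq) = inj₂ (b , ∈-++⁺ˡ b∈ , eq)
    ...   | inj₂ uncovered = inj₁ uncovered

    arcsIn : Fin k → List ℕ
    arcsIn i = filter (λ j → lab W j ≟ᶠ i) arcsW′

    ∈-arcsIn⁻ : ∀ {i a} → a ∈ˡ arcsIn i → a ∈ˡ arcsW′ × lab W a ≡ i
    ∈-arcsIn⁻ {i} = ∈-filter⁻ (λ j → lab W j ≟ᶠ i)

    ∈-arcsIn⇒Arc : ∀ {i a} → a ∈ˡ arcsIn i → Arc 𝕄 𝔹 i (x W a) (x W (suc a))
    ∈-arcsIn⇒Arc a∈ with ∈-arcsIn⁻ a∈
    ... | a∈W′ , refl = arcs W _ (arcsW′-in-W a∈W′)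

    ∈-△⇔ : ∀ {i v} → v ∈ (𝔹 △ W′) i ⇔
           ((v ∈ 𝔹 i × v ∉ˡ map (x W) (arcsIn i)) ⊎ v ∈ˡ map (x W ∘′ suc) (arcsIn i))
    ∈-△⇔ {i} {v} = mk⇔ to from
      where
      P? : Decidable (λ j → lab W j ≡ i)
      P? j = lab W j ≟ᶠ i
      tails heads : Subset N
      tails = select P? (x W) arcsW′
      heads = select P? (x W ∘′ suc) arcsW′
      to : v ∈ (𝔹 i ─ tails) ∪ heads →
           (v ∈ 𝔹 i × v ∉ˡ map (x W) (arcsIn i)) ⊎ v ∈ˡ map (x W ∘′ suc) (arcsIn i)
      to v∈ with x∈p∪q⁻ (𝔹 i ─ tails) heads v∈
      ... | inj₁ v∈B─tails =
        inj₁ (p─q⊆p (𝔹 i) tails v∈B─tails ,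
              x∈p─q⇒x∉q (𝔹 i) tails v∈B─tails ∘′ Equivalence.from (∈-select⇔ P? (x W) arcsW′))
      ... | inj₂ v∈heads = inj₂ (Equivalence.to (∈-select⇔ P? (x W ∘′ suc) arcsW′) v∈heads)
      from : (v ∈ 𝔹 i × v ∉ˡ map (x W) (arcsIn i)) ⊎ v ∈ˡ map (x W ∘′ suc) (arcsIn i) →
             v ∈ (𝔹 i ─ tails) ∪ heads
      from (inj₁ (v∈B , v∉tails)) =
        x∈p∪q⁺ (inj₁ (x∈p∧x∉q⇒x∈p─q v∈B (v∉tails ∘′ Equivalence.to (∈-select⇔ P? (x W) arcsW′))))
      from (inj₂ v∈heads) =
        x∈p∪q⁺ {p = 𝔹 i ─ tails} (inj₂ (Equivalence.from (∈-select⇔ P? (x W ∘′ suc) arcsW′) v∈heads))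

    sortedArcsIn : Fin k → List ℕ
    sortedArcsIn i = filter (_∈? arcsIn i) ≺-order

    sortedArcsIn⊆arcsIn : ∀ {i} → sortedArcsIn i ⊆ˡ arcsIn i
    sortedArcsIn⊆arcsIn {i} = proj₂ ∘′ ∈-filter⁻ (_∈? arcsIn i)

    arcsIn⊆sortedArcsIn : ∀ {i} → arcsIn i ⊆ˡ sortedArcsIn i
    arcsIn⊆sortedArcsIn {i} a∈ =
      ∈-filter⁺ (_∈? arcsIn i) (∈-≺-order (arcsW′-in-W (proj₁ (∈-arcsIn⁻ a∈)))) a∈

    sortedArcsIn-pairs : ∀ {i} {R : ℕ → ℕ → Set} →
      (∀ {a b} → a ∈ˡ arcsIn i → b ∈ˡ arcsIn i → a ≢ b → pos W a ≤ pos W b → R a b) →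
      AllPairs R (sortedArcsIn i)
    sortedArcsIn-pairs {i} f =
      AllPairs-map-All (λ a∈ b∈ (a≢b , a≤b) → f a∈ b∈ a≢b a≤b)
        (all-filter (_∈? arcsIn i) ≺-order) (AllPairs.filter⁺ (_∈? arcsIn i) ≺-order-sorted)

    exchangePairs : Fin k → List (Fin N × Fin N)
    exchangePairs i = map (λ j → x W j , x W (suc j)) (sortedArcsIn i)

    exchangePairs-exchangeable : ∀ i → All (Exchangeable (𝕄 i) (𝔹 i)) (exchangePairs i)
    exchangePairs-exchangeable i = All-map⁺ (All.tabulate exchangeable)
      where
      exchangeable : ∀ {a} → a ∈ˡ sortedArcsIn i → Exchangeable (𝕄 i) (𝔹 i) (x W a , x W (suc a))
      exchangeable a∈ with ∈-arcsIn⇒Arc (sortedArcsIn⊆arcsIn a∈)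
      ... | tail∈ , _ , head∉ , basis = tail∈ , head∉ , basis

    exchangePairs-distinct : ∀ i →
      AllPairs (λ (x , y) (x′ , y′) → x ≢ x′ × y ≢ y′) (exchangePairs i)
    exchangePairs-distinct i = AllPairs.map⁺ (sortedArcsIn-pairs λ a∈ b∈ a≢b _ →
      distinct-arcs (proj₁ (∈-arcsIn⁻ a∈)) (proj₁ (∈-arcsIn⁻ b∈)) a≢b)

    exchangePairs-no-shortcut : ShortcutFree W → ∀ i → AllPairs (NoShortcut (𝕄 i) (𝔹 i)) (exchangePairs i)
    exchangePairs-no-shortcut shortcut-free i = AllPairs.map⁺ (sortedArcsIn-pairs no-shortcut)
      where
      no-shortcut : ∀ {a b} → a ∈ˡ arcsIn i → b ∈ˡ arcsIn i → a ≢ b → pos W a ≤ pos W b →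
                    NoShortcut (𝕄 i) (𝔹 i) (x W a , x W (suc a)) (x W b , x W (suc b))
      no-shortcut {a} {b} a∈ b∈ a≢b a≤b = tails≢ , heads≢ , not-arc (m≤n⇒m<n∨m≡n a≤b)
        where
        a∈W′ : a ∈ˡ arcsW′
        a∈W′ = proj₁ (∈-arcsIn⁻ a∈)
        b∈W′ : b ∈ˡ arcsW′
        b∈W′ = proj₁ (∈-arcsIn⁻ b∈)
        tails≢ : x W a ≢ x W b
        tails≢ = proj₁ (distinct-arcs a∈W′ b∈W′ a≢b)
        heads≢ : x W (suc a) ≢ x W (suc b)
        heads≢ = proj₂ (distinct-arcs a∈W′ b∈W′ a≢b)
        not-arc : pos W a < pos W b ⊎ pos W a ≡ pos W b → ¬ IsBasis (𝕄 i) (𝔹 i [ x W a ↦ x W (suc b) ])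
        not-arc (inj₁ a≺b) basis with ∈-arcsIn⇒Arc a∈ | ∈-arcsIn⇒Arc b∈
        ... | tail∈ , _ | _ , head∈E , head∉ , _ =
          shortcut-free i a b (arcsW′-in-W a∈W′) (arcsW′-in-W b∈W′)
            (proj₂ (∈-arcsIn⁻ a∈)) (proj₂ (∈-arcsIn⁻ b∈)) a≺b (tail∈ , head∈E , head∉ , basis)
        not-arc (inj₂ pos≡) _ = tails≢ (trans (sym (x-pos a)) (trans (cong (x W) pos≡) (x-pos b)))

    △≡exchangeAll : ∀ i → (𝔹 △ W′) i ≡ exchangeAll (𝔹 i) (exchangePairs i)
    △≡exchangeAll i = ⊆-antisym to from
      where
      tails≡ : map proj₁ (exchangePairs i) ≡ map (x W) (sortedArcsIn i)
      tails≡ = sym (map-∘ (sortedArcsIn i))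
      heads≡ : map proj₂ (exchangePairs i) ≡ map (x W ∘′ suc) (sortedArcsIn i)
      heads≡ = sym (map-∘ (sortedArcsIn i))
      ∈-exchangeAll : ∀ {v} → v ∈ exchangeAll (𝔹 i) (exchangePairs i) ⇔
        ((v ∈ 𝔹 i × v ∉ˡ map proj₁ (exchangePairs i)) ⊎ v ∈ˡ map proj₂ (exchangePairs i))
      ∈-exchangeAll = ∈-exchangeAll⇔
        (All.map (λ (tail∈ , head∉ , _) → tail∈ , head∉) (exchangePairs-exchangeable i))
        (exchangePairs-distinct i)
      to : ∀ {v} → v ∈ (𝔹 △ W′) i → v ∈ exchangeAll (𝔹 i) (exchangePairs i)
      to {v} v∈ with Equivalence.to ∈-△⇔ v∈
      ... | inj₁ (v∈B , v∉tails) = Equivalence.from ∈-exchangeAll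
              (inj₁ (v∈B , v∉tails ∘′ Sub.map⁺ (x W) sortedArcsIn⊆arcsIn ∘′ subst (v ∈ˡ_) tails≡))
      ... | inj₂ v∈heads = Equivalence.from ∈-exchangeAll
              (inj₂ (subst (v ∈ˡ_) (sym heads≡) (Sub.map⁺ (x W ∘′ suc) arcsIn⊆sortedArcsIn v∈heads)))
      from : ∀ {v} → v ∈ exchangeAll (𝔹 i) (exchangePairs i) → v ∈ (𝔹 △ W′) i
      from {v} v∈ with Equivalence.to ∈-exchangeAll v∈
      ... | inj₁ (v∈B , v∉tails) = Equivalence.from ∈-△⇔
              (inj₁ (v∈B , v∉tails ∘′ subst (v ∈ˡ_) (sym tails≡) ∘′ Sub.map⁺ (x W) arcsIn⊆sortedArcsIn))
      ... | inj₂ v∈heads = Equivalence.from ∈-△⇔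
              (inj₂ (Sub.map⁺ (x W ∘′ suc) sortedArcsIn⊆arcsIn (subst (v ∈ˡ_) heads≡ v∈heads)))

    △-isBasis : ShortcutFree W → (∀ i → IsBasis (𝕄 i) (𝔹 i)) → ∀ i → IsBasis (𝕄 i) ((𝔹 △ W′) i)
    △-isBasis shortcut-free bases i =
      subst (IsBasis (𝕄 i)) (sym (△≡exchangeAll i))
        (exchangeAll-isBasis (𝕄 i) (bases i)
          (exchangePairs-exchangeable i) (exchangePairs-no-shortcut shortcut-free i))

    module _ (disjoint : PairwiseDisjoint 𝔹) where

      kept∉heads : ∀ {i j v} → v ∈ 𝔹 i → v ∉ˡ map (x W) (arcsIn i) →
                   v ∉ˡ map (x W ∘′ suc) (arcsIn j)
      kept∉heads {i} {j} v∈B v∉tails v∈heads with ∈-map⁻ (x W ∘′ suc) v∈heads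
      ... | a , a∈ , refl with head-continues (proj₁ (∈-arcsIn⁻ a∈))
      ...   | inj₁ uncovered = uncovered i v∈B
      ...   | inj₂ (b , b∈ , tail≡head) with lab W b ≟ᶠ i
      ...     | yes lab-b = v∉tails (subst (_∈ˡ map (x W) (arcsIn i)) tail≡head
                                       (∈-map⁺ (x W) (∈-filter⁺ (λ j → lab W j ≟ᶠ i) b∈ lab-b)))
      ...     | no lab-b≢i = disjoint (lab W b) i lab-b≢i (x W b) (proj₁ (arcs W b (arcsW′-in-W b∈)))
                                      (subst (_∈ 𝔹 i) (sym tail≡head) v∈B)

      △-disjoint : PairwiseDisjoint (𝔹 △ W′)
      △-disjoint i j i≢j v v∈i v∈j with Equivalence.to ∈-△⇔ v∈i | Equivalence.to ∈-△⇔ v∈j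
      ... | inj₁ (v∈Bi , _) | inj₁ (v∈Bj , _) = disjoint i j i≢j v v∈Bi v∈Bj
      ... | inj₁ (v∈Bi , v∉tails) | inj₂ v∈heads = kept∉heads v∈Bi v∉tails v∈heads
      ... | inj₂ v∈heads | inj₁ (v∈Bj , v∉tails) = kept∉heads v∈Bj v∉tails v∈heads
      ... | inj₂ v∈heads-i | inj₂ v∈heads-j
        with ∈-map⁻ (x W ∘′ suc) v∈heads-i | ∈-map⁻ (x W ∘′ suc) v∈heads-j
      ...   | a , a∈ , refl | b , b∈ , head≡ with ∈-arcsIn⁻ a∈ | ∈-arcsIn⁻ b∈
      ...     | a∈W′ , refl | b∈W′ , refl =
        i≢j (cong (lab W) (heads-injective (arcsW′-in-W a∈W′) (arcsW′-in-W b∈W′) head≡))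

lemma2 : ∀ {N k} (𝕄 : Fin k → Matroid N) (𝔹 : Fin k → Subset N) →
         FeasibleBasisSeq 𝕄 𝔹 →
         (W : TadpoleWalk 𝕄 𝔹) → ShortcutFree W →
         (W' : ValidSubgraph W) →
         FeasibleBasisSeq 𝕄 (𝔹 △ W')
lemma2 𝕄 𝔹 (bases , disjoint) W shortcut-free W′ =
  △-isBasis W W′ shortcut-free bases , △-disjoint W W′ disjoint
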